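{- For each closed $\mathrm{ACP}^{\tau}_{\mathrm{drt}}$ term $t$ there exists a basic term $t'$ such that the equation $t=t'$ is derivable (in equational logic) from the axioms of $\mathrm{ACP}^{\tau}_{\mathrm{drt}}$.
   Context: Fix a finite set $A$ of basic actions with $\tau,\delta\notin A$, and a commutative and associative function $\gamma:(A\cup\{\tau,\delta\})\times(A\cup\{\tau,\delta\})\to A\cup\{\tau,\delta\}$ with $\gamma(\tau,a)=\gamma(\delta,a)=\delta$ for all $a$. The signature of $\mathrm{ACP}^{\tau}_{\mathrm{drt}}$ consists of the constants $\underline{a}$ ($a\in A$), $\underline{\tau}$, $\underline{\delta}$; the binary operators $+$, $\cdot$, $\parallel$ (parallel composition), $\lfloor\!\lfloor$ (left merge), $\mid$ (communication merge); and the unary operators $\sigma$ (one-time-slice delay), $\partial_H$ for each $H\subseteq A$, $\tau_I$ for each $I\subseteq A$, and $\nu$ (current-time-slice time-out). In terms, $\cdot$ binds strongest and $+$ weakest. The axioms of $\mathrm{ACP}^{\tau}_{\mathrm{drt}}$ are the following equations, where $a,b,c$ range over $A\cup\{\tau,\delta\}$ and $H,I\subseteq A$: $x+y=y+x$; $(x+y)+z=x+(y+z)$; $x+x=x$; $(x+y)\cdot z=x\cdot z+y\cdot z$; $(x\cdot y)\cdot z=x\cdot(y\cdot z)$; $x+\underline{\delta}=x$; $\underline{\delta}\cdot x=\underline{\delta}$; $\sigma(x)+\sigma(y)=\sigma(x+y)$; $\sigma(x)\cdot y=\sigma(x\cdot y)$; $\partial_H(\underline a)=\underline a$ if $a\notin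 H$; $\partial_H(\underline a)=\underline\delta$ if $a\in H$; $\partial_H(x+y)=\partial_H(x)+\partial_H(y)$; $\partial_H(x\cdot y)=\partial_H(x)\cdot\partial_H(y)$; $\partial_H(\sigma(x))=\sigma(\partial_H(x))$; $\tau_I(\underline a)=\underline a$ if $a\notin I$; $\tau_I(\underline a)=\underline\tau$ if $a\in I$; $\tau_I(x+y)=\tau_I(x)+\tau_I(y)$; $\tau_I(x\cdot y)=\tau_I(x)\cdot\tau_I(y)$; $\tau_I(\sigma(x))=\sigma(\tau_I(x))$; $x\parallel y=(x\lfloor\!\lfloor y+y\lfloor\!\lfloor x)+x\mid y$; $\underline a\lfloor\!\lfloor x=\underline a\cdot x$; $\underline a\cdot x\lfloor\!\lfloor y=\underline a\cdot(x\parallel y)$; $\sigma(x)\lfloor\!\lfloor\nu(y)=\underline\delta$; $\sigma(x)\lfloor\!\lfloor(\nu(y)+\sigma(z))=\sigma(x\lfloor\!\lfloor z)$; $(x+y)\lfloor\!\lfloor z=x\lfloor\!\lfloor z+y\lfloor\!\lfloor z$; $\underline a\cdot x\mid\underline b=(\underline a\mid\underline b)\cdot x$; $\underline a\mid\underline b\cdot x=(\underline a\mid\underline b)\cdot x$; $\underline a\cdot x\mid\underline b\cdot y=(\underline a\mid\underline b)\cdot(x\parallel y)$; $\nu(x)\mid\sigma(y)=\underline\delta$; $\sigma(x)\mid\nu(y)=\underline\delta$; $\sigma(x)\mid\sigma(y)=\sigma(x\mid y)$; $(x+y)\mid z=x\mid z+y\mid z$; $x\mid(y+z)=x\mid y+x\mid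 z$; $\underline a\mid\underline b=\underline c$ if $\gamma(a,b)=c$; $\nu(\underline a)=\underline a$; $\nu(x+y)=\nu(x)+\nu(y)$; $\nu(x\cdot y)=\nu(x)\cdot y$; $\nu(\sigma(x))=\underline\delta$; $\underline a\cdot\underline\tau=\underline a$; $\underline a\cdot(\underline\tau\cdot(\nu(x)+y)+\nu(x))=\underline a\cdot(\nu(x)+y)$; $\underline a\cdot(\underline\tau\cdot(\nu(x)+y)+y)=\underline a\cdot(\nu(x)+y)$; $\underline a\cdot(\sigma(\underline\tau\cdot x)+\nu(y))=\underline a\cdot(\sigma(x)+\nu(y))$. The set of basic terms is the smallest set $\mathcal B$ of closed terms such that: $\underline a\in\mathcal B$ for $a\in A\cup\{\tau,\delta\}$; $\underline a\cdot t\in\mathcal B$ for $a\in A\cup\{\tau\}$ and $t\in\mathcal B$; $\sigma(t)\in\mathcal B$ for $t\in\mathcal B$; $t+t'\in\mathcal B$ for $t,t'\in\mathcal B$. -}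

module Defs where

open import Data.Nat using (ℕ)
open import Data.Fin using (Fin)
open import Data.Fin.Subset using (Subset; _∈_)
open import Relation.Nullary using (¬_)
open import Relation.Binary.PropositionalEquality using (_≡_)

-- The finite set A of basic actions is  Fin n  (an arbitrary finite set).
-- Ext n  is  A ∪ {τ, δ}.
data Ext (n : ℕ) : Set where
  act   : Fin n → Ext n
  tau   : Ext n
  delta : Ext n

-- membership of an element of A ∪ {τ,δ} in a subset H ⊆ A
-- (τ and δ are never in H, since H ⊆ A)
data _∈ᴬ_ {n : ℕ} : Ext n → Subset n → Set where
  act∈ : ∀ {a H} → a ∈ H → act a ∈ᴬ H

_∉ᴬ_ : ∀ {n} → Ext n → Subset n → Set
e ∉ᴬ H = ¬ (e ∈ᴬ H)

infixl 6 _⊕_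
infixl 8 _⊙_
infixl 7 _∥_ _⌊⌊_ _∣_

data Term (n : ℕ) : Set where
  ‵_    : Ext n → Term n
  _⊕_   : Term n → Term n → Term n
  _⊙_   : Term n → Term n → Term n
  _∥_   : Term n → Term n → Term n
  _⌊⌊_  : Term n → Term n → Term n
  _∣_   : Term n → Term n → Term n
  σ     : Term n → Term n
  ∂     : Subset n → Term n → Term n
  τᴵ    : Subset n → Term n → Term n
  ν     : Term n → Term n

data Basic {n : ℕ} : Term n → Set where
  b-const : (a : Ext n) → Basic (‵ a)
  b-act   : (a : Fin n) {t : Term n} → Basic t → Basic (‵ act a ⊙ t)
  b-tau   : {t : Term n} → Basic t → Basic (‵ tau ⊙ t)
  b-σ     : {t : Term n} → Basic t → Basic (σ t)
  b-+     : {t t' : Term n} → Basic t → Basic t' → Basic (t ⊕ t')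

-- Derivability in equational logic from the axioms of ACP^τ_drt,
-- for closed equations (axiom instances with closed terms substituted
-- for the variables, closed under equivalence and congruence).
-- a, b range over A ∪ {τ, δ}.
module Derivation {n : ℕ} (γ : Ext n → Ext n → Ext n) where

  infix 4 _≈_
  data _≈_ : Term n → Term n → Set where
    refl  : ∀ {t} → t ≈ t
    sym   : ∀ {t u} → t ≈ u → u ≈ t
    trans : ∀ {t u v} → t ≈ u → u ≈ v → t ≈ v
    cong-⊕  : ∀ {t t' u u'} → t ≈ t' → u ≈ u' → t ⊕ u ≈ t' ⊕ u'
    cong-⊙  : ∀ {t t' u u'} → t ≈ t' → u ≈ u' → t ⊙ u ≈ t' ⊙ u'
    cong-∥  : ∀ {t t' u u'} → t ≈ t' → u ≈ u' → t ∥ u ≈ t' ∥ u'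
    cong-⌊⌊ : ∀ {t t' u u'} → t ≈ t' → u ≈ u' → t ⌊⌊ u ≈ t' ⌊⌊ u'
    cong-∣  : ∀ {t t' u u'} → t ≈ t' → u ≈ u' → t ∣ u ≈ t' ∣ u'
    cong-σ  : ∀ {t t'} → t ≈ t' → σ t ≈ σ t'
    cong-∂  : ∀ {H t t'} → t ≈ t' → ∂ H t ≈ ∂ H t'
    cong-τᴵ : ∀ {I t t'} → t ≈ t' → τᴵ I t ≈ τᴵ I t'
    cong-ν  : ∀ {t t'} → t ≈ t' → ν t ≈ ν t'
    A1  : ∀ x y → x ⊕ y ≈ y ⊕ x
    A2  : ∀ x y z → (x ⊕ y) ⊕ z ≈ x ⊕ (y ⊕ z)
    A3  : ∀ x → x ⊕ x ≈ x
    A4  : ∀ x y z → (x ⊕ y) ⊙ z ≈ x ⊙ z ⊕ y ⊙ z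
    A5  : ∀ x y z → (x ⊙ y) ⊙ z ≈ x ⊙ (y ⊙ z)
    A6  : ∀ x → x ⊕ ‵ delta ≈ x
    A7  : ∀ x → ‵ delta ⊙ x ≈ ‵ delta
    DRT1 : ∀ x y → σ x ⊕ σ y ≈ σ (x ⊕ y)
    DRT2 : ∀ x y → σ x ⊙ y ≈ σ (x ⊙ y)
    D1 : ∀ {a H} → a ∉ᴬ H → ∂ H (‵ a) ≈ ‵ a
    D2 : ∀ {a H} → a ∈ᴬ H → ∂ H (‵ a) ≈ ‵ delta
    D3 : ∀ H x y → ∂ H (x ⊕ y) ≈ ∂ H x ⊕ ∂ H y
    D4 : ∀ H x y → ∂ H (x ⊙ y) ≈ ∂ H x ⊙ ∂ H y
    DRD : ∀ H x → ∂ H (σ x) ≈ σ (∂ H x)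
    TI1 : ∀ {a I} → a ∉ᴬ I → τᴵ I (‵ a) ≈ ‵ a
    TI2 : ∀ {a I} → a ∈ᴬ I → τᴵ I (‵ a) ≈ ‵ tau
    TI3 : ∀ I x y → τᴵ I (x ⊕ y) ≈ τᴵ I x ⊕ τᴵ I y
    TI4 : ∀ I x y → τᴵ I (x ⊙ y) ≈ τᴵ I x ⊙ τᴵ I y
    DRTI : ∀ I x → τᴵ I (σ x) ≈ σ (τᴵ I x)
    CM1  : ∀ x y → x ∥ y ≈ (x ⌊⌊ y ⊕ y ⌊⌊ x) ⊕ x ∣ y
    CM2  : ∀ a x → ‵ a ⌊⌊ x ≈ ‵ a ⊙ x
    CM3  : ∀ a x y → ‵ a ⊙ x ⌊⌊ y ≈ ‵ a ⊙ (x ∥ y)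
    DRCM1 : ∀ x y → σ x ⌊⌊ ν y ≈ ‵ delta
    DRCM2 : ∀ x y z → σ x ⌊⌊ (ν y ⊕ σ z) ≈ σ (x ⌊⌊ z)
    CM4  : ∀ x y z → (x ⊕ y) ⌊⌊ z ≈ x ⌊⌊ z ⊕ y ⌊⌊ z
    CM5  : ∀ a b x → ‵ a ⊙ x ∣ ‵ b ≈ (‵ a ∣ ‵ b) ⊙ x
    CM6  : ∀ a b x → ‵ a ∣ ‵ b ⊙ x ≈ (‵ a ∣ ‵ b) ⊙ x
    CM7  : ∀ a b x y → ‵ a ⊙ x ∣ ‵ b ⊙ y ≈ (‵ a ∣ ‵ b) ⊙ (x ∥ y)
    DRCM3 : ∀ x y → ν x ∣ σ y ≈ ‵ delta
    DRCM4 : ∀ x y → σ x ∣ ν y ≈ ‵ delta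
    DRCM5 : ∀ x y → σ x ∣ σ y ≈ σ (x ∣ y)
    CM8  : ∀ x y z → (x ⊕ y) ∣ z ≈ x ∣ z ⊕ y ∣ z
    CM9  : ∀ x y z → x ∣ (y ⊕ z) ≈ x ∣ y ⊕ x ∣ z
    CF   : ∀ a b → ‵ a ∣ ‵ b ≈ ‵ (γ a b)
    NU1 : ∀ a → ν (‵ a) ≈ ‵ a
    NU2 : ∀ x y → ν (x ⊕ y) ≈ ν x ⊕ ν y
    NU3 : ∀ x y → ν (x ⊙ y) ≈ ν x ⊙ y
    NU4 : ∀ x → ν (σ x) ≈ ‵ delta
    B1  : ∀ a → ‵ a ⊙ ‵ tau ≈ ‵ a
    DRB1 : ∀ a x y → ‵ a ⊙ (‵ tau ⊙ (ν x ⊕ y) ⊕ ν x) ≈ ‵ a ⊙ (ν x ⊕ y)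
    DRB2 : ∀ a x y → ‵ a ⊙ (‵ tau ⊙ (ν x ⊕ y) ⊕ y) ≈ ‵ a ⊙ (ν x ⊕ y)
    DRB3 : ∀ a x y → ‵ a ⊙ (σ (‵ tau ⊙ x) ⊕ ν y) ≈ ‵ a ⊙ (σ x ⊕ ν y)

{-# OPTIONS --safe #-}
module Submission where

open import Defs
open import Algebra.Bundles using (CommutativeMonoid)
import Algebra.Properties.CommutativeSemigroup as CommutativeSemigroupProperties
open import Data.Nat using (ℕ)
open import Data.Fin.Subset using (Subset)
open import Data.Fin.Subset.Properties using (_∈?_)
open import Data.Product using (Σ; _×_; _,_)
open import Level using (0ℓ)
open import Relation.Binary.PropositionalEquality using (_≡_)
import Relation.Binary.Reasoning.Setoid as SetoidReasoning
open import Relation.Nullary using (yes; no)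

-- Every closed term is provably equal to a normal form  u ⊕ σ z  (or just  u),
-- where the undelayed part u is a sum of constants and prefixes  a ⊙ v  of
-- normal forms and z is again a normal form; such terms are basic. The axioms separating the current time slice from later
-- ones are phrased with ν, and ν fixes every undelayed term: hence
-- ν (u ⊕ σ z) = u, and in ⌊⌊ and ∣ every summand pairing a delayed with an
-- undelayed part is δ.
-- Parallel composition unfolds by CM1 into ⌊⌊ and ∣, which only call it back
-- on the continuations of prefixes, so the mutual recursion terminates.

module Normalisation {n : ℕ} (γ : Ext n → Ext n → Ext n) where
  open Derivation γ

  ⊕-commutativeMonoid : CommutativeMonoid 0ℓ 0ℓ
  ⊕-commutativeMonoid = record
    { Carrier = Term n
    ; _≈_ = _≈_
    ; _∙_ = _⊕_
    ; ε = ‵ delta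
    ; isCommutativeMonoid = record
      { isMonoid = record
        { isSemigroup = record
          { isMagma = record
            { isEquivalence = record { refl = refl ; sym = sym ; trans = trans }
            ; ∙-cong = cong-⊕
            }
          ; assoc = A2
          }
        ; identity = (λ x → trans (A1 _ _) (A6 x)) , A6
        }
      ; comm = A1
      }
    }

  open CommutativeMonoid ⊕-commutativeMonoid using (setoid; identityˡ; commutativeSemigroup)
  open CommutativeSemigroupProperties commutativeSemigroup using (interchange; xy∙z≈xz∙y)
  open SetoidReasoning setoid

  data NonDelta : Ext n → Set where
    act : ∀ a → NonDelta (act a)
    tau : NonDelta tau

  mutual
    data Undelayed : Term n → Set where
      const  : ∀ e → Undelayed (‵ e)
      prefix : ∀ {a t} → NonDelta a → Normal t → Undelayed (‵ a ⊙ t)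
      _⊕ᵘ_   : ∀ {t u} → Undelayed t → Undelayed u → Undelayed (t ⊕ u)

    data Normal : Term n → Set where
      now  : ∀ {t} → Undelayed t → Normal t
      _⊕σ_ : ∀ {t z} → Undelayed t → Normal z → Normal (t ⊕ σ z)

  mutual
    undelayed⇒basic : ∀ {t} → Undelayed t → Basic t
    undelayed⇒basic (const e)          = b-const e
    undelayed⇒basic (prefix (act a) c) = b-act a (normal⇒basic c)
    undelayed⇒basic (prefix tau c)     = b-tau (normal⇒basic c)
    undelayed⇒basic (p ⊕ᵘ q)           = b-+ (undelayed⇒basic p) (undelayed⇒basic q)

    normal⇒basic : ∀ {t} → Normal t → Basic t
    normal⇒basic (now p)  = undelayed⇒basic p
    normal⇒basic (p ⊕σ z) = b-+ (undelayed⇒basic p) (b-σ (normal⇒basic z))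

  Form : (Term n → Set) → Term n → Set
  Form P t = Σ (Term n) λ t′ → P t′ × t ≈ t′

  infixr 1 _◃_
  infixl 6 _⊕ᶠ_ _⊕σᶠ_

  _◃_ : ∀ {P t u} → t ≈ u → Form P u → Form P t
  eq ◃ (v , p , eq′) = v , p , trans eq eq′

  ⌜_⌝ : ∀ {P : Term n → Set} {t} → P t → Form P t
  ⌜ p ⌝ = _ , p , refl

  undelayed : ∀ {t} → Form Undelayed t → Form Normal t
  undelayed (v , p , eq) = v , now p , eq

  _⊕ᶠ_ : ∀ {t u} → Form Undelayed t → Form Undelayed u → Form Undelayed (t ⊕ u)
  (v , p , eq) ⊕ᶠ (w , q , eq′) = v ⊕ w , p ⊕ᵘ q , cong-⊕ eq eq′

  _⊕σᶠ_ : ∀ {t z} → Form Undelayed t → Form Normal z → Form Normal (t ⊕ σ z)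
  (v , p , eq) ⊕σᶠ (w , c , eq′) = v ⊕ σ w , p ⊕σ c , cong-⊕ eq (cong-σ eq′)

  prefixᶠ : ∀ e {t} → Form Normal t → Form Undelayed (‵ e ⊙ t)
  prefixᶠ (act a) (v , c , eq) = _ , prefix (act a) c , cong-⊙ refl eq
  prefixᶠ tau     (v , c , eq) = _ , prefix tau c , cong-⊙ refl eq
  prefixᶠ delta   _            = _ , const delta , A7 _

  lift₁ : ∀ {f : Term n → Term n} → (∀ {t t′} → t ≈ t′ → f t ≈ f t′)
        → (∀ {t} → Normal t → Form Normal (f t))
        → ∀ {t} → Form Normal t → Form Normal (f t)
  lift₁ cong f (v , c , eq) = cong eq ◃ f c

  lift₂ : ∀ {_∙_ : Term n → Term n → Term n}
        → (∀ {t t′ u u′} → t ≈ t′ → u ≈ u′ → t ∙ u ≈ t′ ∙ u′)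
        → (∀ {t u} → Normal t → Normal u → Form Normal (t ∙ u))
        → ∀ {t u} → Form Normal t → Form Normal u → Form Normal (t ∙ u)
  lift₂ cong f (v , c , eq) (w , d , eq′) = cong eq eq′ ◃ f c d

  _⊕ⁿ_ : ∀ {t u} → Normal t → Normal u → Form Normal (t ⊕ u)
  now p    ⊕ⁿ now q    = ⌜ now (p ⊕ᵘ q) ⌝
  now p    ⊕ⁿ (q ⊕σ w) = sym (A2 _ _ _) ◃ ⌜ (p ⊕ᵘ q) ⊕σ w ⌝
  (p ⊕σ z) ⊕ⁿ now q    = xy∙z≈xz∙y _ _ _ ◃ ⌜ (p ⊕ᵘ q) ⊕σ z ⌝
  (p ⊕σ z) ⊕ⁿ (q ⊕σ w) =
    trans (interchange _ _ _ _) (cong-⊕ refl (DRT1 _ _)) ◃ ⌜ p ⊕ᵘ q ⌝ ⊕σᶠ z ⊕ⁿ w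

  mutual
    _⊙ᵘ_ : ∀ {t u} → Undelayed t → Normal u → Form Undelayed (t ⊙ u)
    const e        ⊙ᵘ d = prefixᶠ e ⌜ d ⌝
    prefix {a} _ c ⊙ᵘ d = A5 _ _ _ ◃ prefixᶠ a (c ⊙ⁿ d)
    (p ⊕ᵘ q)       ⊙ᵘ d = A4 _ _ _ ◃ p ⊙ᵘ d ⊕ᶠ q ⊙ᵘ d

    _⊙ⁿ_ : ∀ {t u} → Normal t → Normal u → Form Normal (t ⊙ u)
    now p    ⊙ⁿ d = undelayed (p ⊙ᵘ d)
    (p ⊕σ z) ⊙ⁿ d = trans (A4 _ _ _) (cong-⊕ refl (DRT2 _ _)) ◃ p ⊙ᵘ d ⊕σᶠ z ⊙ⁿ d

  record IsRenaming (f : Term n → Term n) : Set where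
    field
      ‵-image : ∀ e → Σ (Ext n) λ e′ → f (‵ e) ≈ ‵ e′
      ⊕-hom   : ∀ x y → f (x ⊕ y) ≈ f x ⊕ f y
      ⊙-hom   : ∀ x y → f (x ⊙ y) ≈ f x ⊙ f y
      σ-hom   : ∀ x → f (σ x) ≈ σ (f x)

  module _ {f : Term n → Term n} (isRenaming : IsRenaming f) where
    open IsRenaming isRenaming

    mutual
      renameᵘ : ∀ {t} → Undelayed t → Form Undelayed (f t)
      renameᵘ (const e) with ‵-image e
      ... | e′ , eq = eq ◃ ⌜ const e′ ⌝
      renameᵘ (prefix {a} _ c) with ‵-image a
      ... | a′ , eq = trans (⊙-hom _ _) (cong-⊙ eq refl) ◃ prefixᶠ a′ (renameⁿ c)
      renameᵘ (p ⊕ᵘ q) = ⊕-hom _ _ ◃ renameᵘ p ⊕ᶠ renameᵘ q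

      renameⁿ : ∀ {t} → Normal t → Form Normal (f t)
      renameⁿ (now p)  = undelayed (renameᵘ p)
      renameⁿ (p ⊕σ z) = trans (⊕-hom _ _) (cong-⊕ refl (σ-hom _)) ◃ renameᵘ p ⊕σᶠ renameⁿ z

  ‵-image-by-membership : ∀ {f : Term n → Term n} (H : Subset n) (x : Ext n)
    → (∀ {a} → a ∈ᴬ H → f (‵ a) ≈ ‵ x) → (∀ {a} → a ∉ᴬ H → f (‵ a) ≈ ‵ a)
    → ∀ e → Σ (Ext n) λ e′ → f (‵ e) ≈ ‵ e′
  ‵-image-by-membership H x inside outside (act a) with a ∈? H
  ... | yes a∈H = x , inside (act∈ a∈H)
  ... | no  a∉H = act a , outside λ { (act∈ a∈H) → a∉H a∈H }
  ‵-image-by-membership H x inside outside tau   = tau , outside λ ()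
  ‵-image-by-membership H x inside outside delta = delta , outside λ ()

  ∂-isRenaming : ∀ H → IsRenaming (∂ H)
  ∂-isRenaming H = record
    { ‵-image = ‵-image-by-membership {∂ H} H delta D2 D1
    ; ⊕-hom = D3 H
    ; ⊙-hom = D4 H
    ; σ-hom = DRD H
    }

  τᴵ-isRenaming : ∀ I → IsRenaming (τᴵ I)
  τᴵ-isRenaming I = record
    { ‵-image = ‵-image-by-membership {τᴵ I} I tau TI2 TI1
    ; ⊕-hom = TI3 I
    ; ⊙-hom = TI4 I
    ; σ-hom = DRTI I
    }

  ν-undelayed : ∀ {t} → Undelayed t → ν t ≈ t
  ν-undelayed (const e)    = NU1 e
  ν-undelayed (prefix _ _) = trans (NU3 _ _) (cong-⊙ (NU1 _) refl)
  ν-undelayed (p ⊕ᵘ q)     = trans (NU2 _ _) (cong-⊕ (ν-undelayed p) (ν-undelayed q))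

  νⁿ : ∀ {t} → Normal t → Form Normal (ν t)
  νⁿ (now p)  = ν-undelayed p ◃ ⌜ now p ⌝
  νⁿ (p ⊕σ z) = trans (NU2 _ _) (trans (cong-⊕ (ν-undelayed p) (NU4 _)) (A6 _)) ◃ ⌜ now p ⌝

  σ⌊⌊-undelayed : ∀ {u z} → Undelayed u → σ z ⌊⌊ u ≈ ‵ delta
  σ⌊⌊-undelayed q = trans (cong-⌊⌊ refl (sym (ν-undelayed q))) (DRCM1 _ _)

  σ⌊⌊-⊕σ : ∀ {u z w} → Undelayed u → σ z ⌊⌊ (u ⊕ σ w) ≈ σ (z ⌊⌊ w)
  σ⌊⌊-⊕σ q = trans (cong-⌊⌊ refl (cong-⊕ (sym (ν-undelayed q)) refl)) (DRCM2 _ _ _)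

  undelayed-∣σ : ∀ {t w} → Undelayed t → t ∣ σ w ≈ ‵ delta
  undelayed-∣σ p = trans (cong-∣ (sym (ν-undelayed p)) refl) (DRCM3 _ _)

  σ∣-undelayed : ∀ {u z} → Undelayed u → σ z ∣ u ≈ ‵ delta
  σ∣-undelayed q = trans (cong-∣ refl (sym (ν-undelayed q))) (DRCM4 _ _)

  ⊕σ-∣-⊕σ : ∀ {t u z w} → Undelayed t → Undelayed u
          → (t ⊕ σ z) ∣ (u ⊕ σ w) ≈ t ∣ u ⊕ σ (z ∣ w)
  ⊕σ-∣-⊕σ {t} {u} {z} {w} p q = begin
    (t ⊕ σ z) ∣ (u ⊕ σ w)                            ≈⟨ CM8 _ _ _ ⟩
    t ∣ (u ⊕ σ w) ⊕ σ z ∣ (u ⊕ σ w)                  ≈⟨ cong-⊕ (CM9 _ _ _) (CM9 _ _ _) ⟩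
    (t ∣ u ⊕ t ∣ σ w) ⊕ (σ z ∣ u ⊕ σ z ∣ σ w)        ≈⟨ cong-⊕ (cong-⊕ refl (undelayed-∣σ p))
                                                                (cong-⊕ (σ∣-undelayed q) (DRCM5 _ _)) ⟩
    (t ∣ u ⊕ ‵ delta) ⊕ (‵ delta ⊕ σ (z ∣ w))        ≈⟨ cong-⊕ (A6 _) (identityˡ _) ⟩
    t ∣ u ⊕ σ (z ∣ w)                                ∎

  communication : ∀ a b {x} → (‵ a ∣ ‵ b) ⊙ x ≈ ‵ γ a b ⊙ x
  communication a b = cong-⊙ (CF a b) refl

  mutual
    _⌊⌊ᵘ_ : ∀ {t u} → Undelayed t → Normal u → Form Undelayed (t ⌊⌊ u)
    const e        ⌊⌊ᵘ d = CM2 e _ ◃ prefixᶠ e ⌜ d ⌝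
    prefix {a} _ c ⌊⌊ᵘ d = CM3 a _ _ ◃ prefixᶠ a (c ∥ⁿ d)
    (p ⊕ᵘ q)       ⌊⌊ᵘ d = CM4 _ _ _ ◃ p ⌊⌊ᵘ d ⊕ᶠ q ⌊⌊ᵘ d

    _⌊⌊ⁿ_ : ∀ {t u} → Normal t → Normal u → Form Normal (t ⌊⌊ u)
    now p    ⌊⌊ⁿ d        = undelayed (p ⌊⌊ᵘ d)
    (p ⊕σ z) ⌊⌊ⁿ now q    =
      trans (CM4 _ _ _) (trans (cong-⊕ refl (σ⌊⌊-undelayed q)) (A6 _)) ◃ undelayed (p ⌊⌊ᵘ now q)
    (p ⊕σ z) ⌊⌊ⁿ (q ⊕σ w) =
      trans (CM4 _ _ _) (cong-⊕ refl (σ⌊⌊-⊕σ q)) ◃ p ⌊⌊ᵘ (q ⊕σ w) ⊕σᶠ z ⌊⌊ⁿ w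

    _∣ᵘ_ : ∀ {t u} → Undelayed t → Undelayed u → Form Undelayed (t ∣ u)
    (p ⊕ᵘ q) ∣ᵘ r = CM8 _ _ _ ◃ p ∣ᵘ r ⊕ᶠ q ∣ᵘ r
    p ∣ᵘ (q ⊕ᵘ r) = CM9 _ _ _ ◃ p ∣ᵘ q ⊕ᶠ p ∣ᵘ r
    const a ∣ᵘ const b = CF a b ◃ ⌜ const (γ a b) ⌝
    prefix {a} _ c ∣ᵘ const b =
      trans (CM5 a b _) (communication a b) ◃ prefixᶠ (γ a b) ⌜ c ⌝
    const a ∣ᵘ prefix {b} _ d =
      trans (CM6 a b _) (communication a b) ◃ prefixᶠ (γ a b) ⌜ d ⌝
    prefix {a} _ c ∣ᵘ prefix {b} _ d =
      trans (CM7 a b _ _) (communication a b) ◃ prefixᶠ (γ a b) (c ∥ⁿ d)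

    _∣ⁿ_ : ∀ {t u} → Normal t → Normal u → Form Normal (t ∣ u)
    now p    ∣ⁿ now q    = undelayed (p ∣ᵘ q)
    now p    ∣ⁿ (q ⊕σ w) =
      trans (CM9 _ _ _) (trans (cong-⊕ refl (undelayed-∣σ p)) (A6 _)) ◃ undelayed (p ∣ᵘ q)
    (p ⊕σ z) ∣ⁿ now q    =
      trans (CM8 _ _ _) (trans (cong-⊕ refl (σ∣-undelayed q)) (A6 _)) ◃ undelayed (p ∣ᵘ q)
    (p ⊕σ z) ∣ⁿ (q ⊕σ w) = ⊕σ-∣-⊕σ p q ◃ p ∣ᵘ q ⊕σᶠ z ∣ⁿ w

    _∥ⁿ_ : ∀ {t u} → Normal t → Normal u → Form Normal (t ∥ u)
    c ∥ⁿ d = CM1 _ _ ◃ ⊕ᶠⁿ (⊕ᶠⁿ (c ⌊⌊ⁿ d) (d ⌊⌊ⁿ c)) (c ∣ⁿ d)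
      where
        ⊕ᶠⁿ : ∀ {t u} → Form Normal t → Form Normal u → Form Normal (t ⊕ u)
        ⊕ᶠⁿ = lift₂ cong-⊕ _⊕ⁿ_

  normalise : (t : Term n) → Form Normal t
  normalise (‵ e)    = ⌜ now (const e) ⌝
  normalise (t ⊕ u)  = lift₂ cong-⊕ _⊕ⁿ_ (normalise t) (normalise u)
  normalise (t ⊙ u)  = lift₂ cong-⊙ _⊙ⁿ_ (normalise t) (normalise u)
  normalise (t ∥ u)  = lift₂ cong-∥ _∥ⁿ_ (normalise t) (normalise u)
  normalise (t ⌊⌊ u) = lift₂ cong-⌊⌊ _⌊⌊ⁿ_ (normalise t) (normalise u)
  normalise (t ∣ u)  = lift₂ cong-∣ _∣ⁿ_ (normalise t) (normalise u)
  normalise (σ t)    = lift₁ cong-σ (λ c → sym (identityˡ _) ◃ ⌜ const delta ⊕σ c ⌝) (normalise t)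
  normalise (∂ H t)  = lift₁ cong-∂ (renameⁿ (∂-isRenaming H)) (normalise t)
  normalise (τᴵ I t) = lift₁ cong-τᴵ (renameⁿ (τᴵ-isRenaming I)) (normalise t)
  normalise (ν t)    = lift₁ cong-ν νⁿ (normalise t)

theorem1 : (n : ℕ) (γ : Ext n → Ext n → Ext n)
    → (∀ a b → γ a b ≡ γ b a)
    → (∀ a b c → γ (γ a b) c ≡ γ a (γ b c))
    → (∀ a → γ tau a ≡ delta)
    → (∀ a → γ delta a ≡ delta)
    → (t : Term n) → Σ (Term n) (λ t' → Basic t' × Derivation._≈_ γ t t')
theorem1 n γ _ _ _ _ t = let t′ , c , eq = normalise t in t′ , normal⇒basic c , eq
  where open Normalisation γ
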